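{- Let $p$ be a prime, $l\in\mathbb{N}$, $x\in\mathcal{X}_{p^l}\setminus\{\infty\}$, and let $p_0/q_0,\dots,p_M/q_M$ ($M\ge0$, $x=p_M/q_M$) be the convergents of an $\mathcal{F}_{p^l}$-continued fraction expansion of $x$ with maximum $+1$; put $q_{ -1}=0$. Then no $u/v\in\mathcal{X}_{p^l}$ with $q_{M-1}<v<q_M$ is a best $\mathcal{X}_{p^l}$-approximation of $x$.
   Context: $\mathcal{X}_{p^l}=\{x/y: x,y\in\mathbb{Z},\ y>0,\ \gcd(x,y)=1,\ p^l\mid y\}\cup\{\infty\}$. An $\mathcal{F}_{p^l}$-continued fraction is a finite expression $\frac{1}{0+}\,\frac{p^l}{b+}\,\frac{\epsilon_1}{a_1+}\cdots\frac{\epsilon_n}{a_n}$ ($n\ge0$) (or an infinite analogue), where $b\in\mathbb{Z}$ is coprime to $p$, $a_i\in\mathbb{N}$, $\epsilon_i\in\{1,-1\}$, and for all relevant $i\ge1$: $a_i+\epsilon_{i+1}\ge1$, $a_i+\epsilon_i\ge1$, $\gcd(p_i,q_i)=1$ where $p_i=a_ip_{i-1}+\epsilon_ip_{i-2}$, $q_i=a_iq_{i-1}+\epsilon_iq_{i-2}$, $(p_{ -1},q_{ -1})=(1,0)$, $(p_0,q_0)=(b,p^l)$. The $p_i/q_i$ are its convergents, and the value of a finite one is its last convergent; an expansion of $x$ is one with value $x$. A finite expansion of $x\in\mathcal{X}_{p^l}$ whose last pair $(\epsilon_n,a_n)\ne(1,1)$ is with maximum $+1$ if, among all $\mathcal{F}_{p^l}$-continued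 fraction expansions of $x$ not ending with $\frac11$, it has the largest number of indices $i\ge2$ with $\epsilon_i=+1$. $u/v\in\mathcal{X}_{p^l}$ (lowest terms, $v>0$) is a best $\mathcal{X}_{p^l}$-approximation of $x$ if $|vx-u|<|v'x-u'|$ for every $u'/v'\in\mathcal{X}_{p^l}$, $u'/v'\ne u/v$, with $0<v'\le v$. -}

module Defs where

open import Data.Nat as ℕ using (ℕ; zero; suc; _^_)
open import Data.Nat.Divisibility using (_∣_)
open import Data.Nat.Coprimality using (Coprime)
open import Data.Nat.Primality using (Prime)
open import Data.Integer as ℤ using (ℤ; +_; ∣_∣; -1ℤ)
open import Data.List using (List; []; _∷_; last; length; filter; drop)
open import Data.List.Relation.Unary.All using (All)
open import Data.Maybe using (Maybe; just; nothing)
open import Data.Product using (_×_; _,_; proj₁; proj₂)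
open import Data.Unit using (⊤)
open import Relation.Binary.PropositionalEquality using (_≡_)
open import Relation.Nullary using (¬_)
open import Relation.Nullary.Decidable using (Dec; yes; no)

data Sgn : Set where
  plus minus : Sgn

sgn : Sgn → ℤ
sgn plus  = + 1
sgn minus = -1ℤ

isPlus : Sgn → Set
isPlus plus = ⊤
isPlus minus = Data.Empty.⊥
  where import Data.Empty

isPlus? : (e : Sgn) → Dec (isPlus e)
isPlus? plus = yes _
isPlus? minus = no (λ ())

-- u/v (u ∈ ℤ, v ∈ ℕ) is a finite element of 𝒳_{p^l}, written in lowest terms
InX : ℕ → ℕ → ℤ → ℕ → Set
InX p l u v = 0 ℕ.< v × Coprime (∣ u ∣) v × (p ^ l) ∣ v

-- An F_{p^l}-continued fraction  1/(0+) p^l/(b+) ε₁/(a₁+) ⋯ εₙ/aₙ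
record CF : Set where
  constructor cf
  field
    b     : ℤ
    terms : List (Sgn × ℕ)
open CF public

Pair : Set
Pair = ℤ × ℤ

step : Pair → Pair → Sgn × ℕ → Pair
step (p₂ , q₂) (p₁ , q₁) (e , a) =
  ((+ a) ℤ.* p₁ ℤ.+ sgn e ℤ.* p₂ , (+ a) ℤ.* q₁ ℤ.+ sgn e ℤ.* q₂)

convsFrom : Pair → Pair → List (Sgn × ℕ) → List Pair
convsFrom prev cur []      = []
convsFrom prev cur (t ∷ ts) = step prev cur t ∷ convsFrom cur (step prev cur t) ts

lastTwoFrom : Pair → Pair → List (Sgn × ℕ) → Pair × Pair
lastTwoFrom prev cur []       = prev , cur
lastTwoFrom prev cur (t ∷ ts) = lastTwoFrom cur (step prev cur t) ts

-- (p_{-1},q_{-1}) = (1,0), (p_0,q_0) = (b,p^l)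
convergentsPos : ℕ → ℕ → CF → List Pair   -- convergents with index i ≥ 1
convergentsPos p l E = convsFrom (+ 1 , + 0) (b E , + (p ^ l)) (terms E)

lastTwo : ℕ → ℕ → CF → Pair × Pair
lastTwo p l E = lastTwoFrom (+ 1 , + 0) (b E , + (p ^ l)) (terms E)

pLast qLast qPrev : ℕ → ℕ → CF → ℤ
pLast p l E = proj₁ (proj₂ (lastTwo p l E))
qLast p l E = proj₂ (proj₂ (lastTwo p l E))
qPrev p l E = proj₂ (proj₁ (lastTwo p l E))

AdjOK : List (Sgn × ℕ) → Set
AdjOK []                            = ⊤
AdjOK (_ ∷ [])                      = ⊤
AdjOK ((e , a) ∷ (e' , a') ∷ ts)    = (+ 1 ℤ.≤ (+ a) ℤ.+ sgn e') × AdjOK ((e' , a') ∷ ts)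

ValidCF : ℕ → ℕ → CF → Set
ValidCF p l E =
  Coprime (∣ b E ∣) p
  × All (λ t → 1 ℕ.≤ proj₂ t × (+ 1 ℤ.≤ (+ proj₂ t) ℤ.+ sgn (proj₁ t))) (terms E)
  × AdjOK (terms E)
  × All (λ c → Coprime (∣ proj₁ c ∣) (∣ proj₂ c ∣)) (convergentsPos p l E)

ExpansionOf : ℕ → ℕ → ℤ → ℕ → CF → Set
ExpansionOf p l P Q E =
  ValidCF p l E × (pLast p l E ℤ.* (+ Q) ≡ P ℤ.* qLast p l E)

EndsWith11 : CF → Set
EndsWith11 E = last (terms E) ≡ just (plus , 1)

-- number of indices i ≥ 2 with ε_i = +1
plusCount : CF → ℕ
plusCount E = length (filter (λ t → isPlus? (proj₁ t)) (drop 1 (terms E)))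

MaxPlus : ℕ → ℕ → ℤ → ℕ → CF → Set
MaxPlus p l P Q E =
  ExpansionOf p l P Q E × ¬ EndsWith11 E
  × (∀ (E' : CF) → ExpansionOf p l P Q E' → ¬ EndsWith11 E' → plusCount E' ℕ.≤ plusCount E)

-- u/v is a best 𝒳_{p^l}-approximation of x = P/Q   ( |v x - u| = |v P - u Q| / Q )
BestApprox : ℕ → ℕ → ℤ → ℕ → ℤ → ℕ → Set
BestApprox p l P Q u v =
  InX p l u v
  × (∀ (u' : ℤ) (v' : ℕ) → InX p l u' v' → ¬ (u' ≡ u × v' ≡ v) → v' ℕ.≤ v →
       ∣ (+ v) ℤ.* P ℤ.- u ℤ.* (+ Q) ∣ ℕ.< ∣ (+ v') ℤ.* P ℤ.- u' ℤ.* (+ Q) ∣)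

-- Consecutive convergents p₋/q₋, p/q of any valid expansion have 0 ≤ q₋ ≤ q, both divisible
-- by D = p^l, and |p q₋ − p₋ q| = D, an invariant carried along by the recursion for the
-- convergents.  If q₋ < v < q and D ∣ v, then |v x − u| = |v p − u q|/q is a nonzero multiple
-- of D/q, so it is at least D/q = |q₋ x − p₋|: the convergent p₋/q₋ is at least as good as
-- u/v and has a smaller denominator.  (When q₋ = 0 we have q ∣ D, so no such v exists.)
module Submission where

open import Defs
open import Data.Nat using (ℕ; _≤_)
open import Data.Nat.Primality using (Prime)
open import Data.Integer using (ℤ; +_; _<_)
open import Relation.Nullary using (¬_)

import Data.Nat as ℕ
import Data.Nat.Properties as ℕ
open import Data.Nat.Divisibility using (_∣_; divides; ∣-refl; ∣-trans; ∣-antisym; ∣⇒≤; ∣1⇒≡1)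
open import Data.Nat.Coprimality as Coprimality using (Coprime; coprime-divisor)
open import Data.Nat.Primality using (prime⇒nonZero)
open import Data.Integer using (_+_; _*_; _-_; -_; ∣_∣; -1ℤ; +≤+; +<+)
import Data.Integer as ℤ
import Data.Integer.Properties as ℤ
import Data.Integer.Divisibility.Signed as ℤ
open import Data.Integer.Tactic.RingSolver using (solve-∀)
open import Data.List using ([]; _∷_)
open import Data.List.Relation.Unary.All using (All; []; _∷_)
open import Data.Product using (∃-syntax; _×_; _,_; proj₁; proj₂; uncurry)
open import Relation.Binary.PropositionalEquality

coprime-^ʳ : ∀ {m n} → Coprime m n → ∀ k → Coprime m (n ℕ.^ k)
coprime-^ʳ m⊥n ℕ.zero (_ , i∣1) = ∣1⇒≡1 i∣1
coprime-^ʳ {m} {n} m⊥n (ℕ.suc k) {i} (i∣m , i∣nnᵏ) =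
  coprime-^ʳ m⊥n k (i∣m , coprime-divisor i⊥n i∣nnᵏ)
  where
  i⊥n : Coprime i n
  i⊥n (j∣i , j∣n) = m⊥n (∣-trans j∣i i∣m , j∣n)

lowest-terms⇒∣ : ∀ {p d : ℤ} {q c : ℕ} → Coprime ∣ p ∣ q → p * + c ≡ d * + q → q ∣ c
lowest-terms⇒∣ {p} {d} {q} {c} p⊥q pc≡dq =
  coprime-divisor (Coprimality.sym p⊥q) (divides ∣ d ∣ ∣pc∣≡∣d∣q)
  where
  ∣pc∣≡∣d∣q : ∣ p ∣ ℕ.* c ≡ ∣ d ∣ ℕ.* q
  ∣pc∣≡∣d∣q = trans (sym (ℤ.abs-* p (+ c))) (trans (cong ∣_∣ pc≡dq) (ℤ.abs-* d (+ q)))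

lowest-terms-unique : ∀ {p P : ℤ} {q Q : ℕ} .{{_ : ℕ.NonZero q}} →
  Coprime ∣ p ∣ q → Coprime ∣ P ∣ Q → p * + Q ≡ P * + q → P ≡ p × Q ≡ q
lowest-terms-unique {p} {P} {q} {Q} p⊥q P⊥Q pQ≡Pq = P≡p , Q≡q
  where
  Q≡q : Q ≡ q
  Q≡q = ∣-antisym (lowest-terms⇒∣ {P} {p} P⊥Q (sym pQ≡Pq)) (lowest-terms⇒∣ {p} {P} p⊥q pQ≡Pq)
  P≡p : P ≡ p
  P≡p = sym (ℤ.*-cancelʳ-≡ p P (+ q) (subst (λ Q′ → p * + Q′ ≡ P * + q) Q≡q pQ≡Pq))

∣-linear-combination : ∀ {D n₋ n m} (a s : ℤ) → D ∣ n₋ → D ∣ n →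
  a * + n + s * + n₋ ≡ + m → D ∣ m
∣-linear-combination {D} {n₋} {n} a s D∣n₋ D∣n eq = ℤ.∣⇒∣ᵤ {+ D}
  (subst (+ D ℤ.∣_) eq (ℤ.∣m∣n⇒∣m+n (ℤ.∣n⇒∣m*n a (ℤ.∣ᵤ⇒∣ {+ D} {+ n} D∣n))
                                   (ℤ.∣n⇒∣m*n s (ℤ.∣ᵤ⇒∣ {+ D} {+ n₋} D∣n₋))))

det : Pair → Pair → ℤ
det prev cur = proj₁ cur * proj₂ prev - proj₁ prev * proj₂ cur

∣det-step∣ : ∀ prev cur t → ∣ det cur (step prev cur t) ∣ ≡ ∣ det prev cur ∣
∣det-step∣ (p₋ , q₋) (p , q) (e , a) = begin
  ∣ det (p , q) (step (p₋ , q₋) (p , q) (e , a)) ∣  ≡⟨ cong ∣_∣ (expand (+ a) (sgn e) p p₋ q q₋) ⟩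
  ∣ - (sgn e * det (p₋ , q₋) (p , q)) ∣             ≡⟨ ℤ.∣-i∣≡∣i∣ (sgn e * det (p₋ , q₋) (p , q)) ⟩
  ∣ sgn e * det (p₋ , q₋) (p , q) ∣                 ≡⟨ ℤ.abs-* (sgn e) _ ⟩
  ∣ sgn e ∣ ℕ.* ∣ det (p₋ , q₋) (p , q) ∣           ≡⟨ cong (ℕ._* _) (∣sgn∣ e) ⟩
  1 ℕ.* ∣ det (p₋ , q₋) (p , q) ∣                   ≡⟨ ℕ.*-identityˡ _ ⟩
  ∣ det (p₋ , q₋) (p , q) ∣                         ∎
  where
  open ≡-Reasoning
  expand : ∀ a s p p₋ q q₋ →
    (a * p + s * p₋) * q - p * (a * q + s * q₋) ≡ - (s * (p * q₋ - p₋ * q))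
  expand = solve-∀
  ∣sgn∣ : ∀ e → ∣ sgn e ∣ ≡ 1
  ∣sgn∣ plus  = refl
  ∣sgn∣ minus = refl

ValidTerm : Sgn × ℕ → Set
ValidTerm t = 1 ℕ.≤ proj₂ t × (+ 1 ℤ.≤ + proj₂ t + sgn (proj₁ t))

-- In the case ε = −1 the condition a + ε ≥ 1 gives a ≥ 2, so a q − q₋ ≥ 2q − q₋ ≥ q.
next-denominator : ∀ t {n₋ n : ℕ} → ValidTerm t → n₋ ≤ n →
  ∃[ m ] (+ proj₂ t * + n + sgn (proj₁ t) * + n₋ ≡ + m × n ≤ m)
next-denominator (plus , a@(ℕ.suc _)) {n₋} {n} _ _ = a ℕ.* n ℕ.+ n₋ , eq , n≤m
  where
  eq : + a * + n + + 1 * + n₋ ≡ + (a ℕ.* n ℕ.+ n₋)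
  eq = trans (cong₂ _+_ (sym (ℤ.pos-* a n)) (ℤ.*-identityˡ (+ n₋))) (sym (ℤ.pos-+ (a ℕ.* n) n₋))
  n≤m : n ≤ a ℕ.* n ℕ.+ n₋
  n≤m = ℕ.≤-trans (ℕ.m≤n*m n a) (ℕ.m≤m+n _ _)
next-denominator (minus , 1) (_ , +≤+ ())
next-denominator (minus , a@(ℕ.suc (ℕ.suc k))) {n₋} {n} _ n₋≤n = a ℕ.* n ℕ.∸ n₋ , eq , n≤m
  where
  n+n₋≤an : n ℕ.+ n₋ ≤ a ℕ.* n
  n+n₋≤an = ℕ.+-monoʳ-≤ n (ℕ.≤-trans n₋≤n (ℕ.m≤m+n n (k ℕ.* n)))
  n₋≤an : n₋ ≤ a ℕ.* n
  n₋≤an = ℕ.≤-trans (ℕ.m≤n+m n₋ n) n+n₋≤an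
  eq : + a * + n + -1ℤ * + n₋ ≡ + (a ℕ.* n ℕ.∸ n₋)
  eq = begin
    + a * + n + -1ℤ * + n₋      ≡⟨ cong₂ _+_ (sym (ℤ.pos-* a n)) (ℤ.-1*i≡-i (+ n₋)) ⟩
    + (a ℕ.* n) - + n₋          ≡⟨ ℤ.m-n≡m⊖n (a ℕ.* n) n₋ ⟩
    a ℕ.* n ℤ.⊖ n₋              ≡⟨ ℤ.⊖-≥ n₋≤an ⟩
    + (a ℕ.* n ℕ.∸ n₋)          ∎
    where open ≡-Reasoning
  n≤m : n ≤ a ℕ.* n ℕ.∸ n₋
  n≤m = ℕ.m+n≤o⇒m≤o∸n n n+n₋≤an

CoprimePair : Pair → Set
CoprimePair c = Coprime ∣ proj₁ c ∣ ∣ proj₂ c ∣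

record Consecutive (D : ℕ) (prev cur : Pair) : Set where
  field
    q₋ q         : ℕ
    prev-den     : proj₂ prev ≡ + q₋
    cur-den      : proj₂ cur ≡ + q
    q₋≤q         : q₋ ≤ q
    D∣q₋         : D ∣ q₋
    D∣q          : D ∣ q
    ∣det∣≡D      : ∣ det prev cur ∣ ≡ D
    prev-coprime : Coprime ∣ proj₁ prev ∣ q₋
    cur-coprime  : Coprime ∣ proj₁ cur ∣ q

consecutive-initial : ∀ {p} l (b : ℤ) → Coprime ∣ b ∣ p →
  Consecutive (p ℕ.^ l) (+ 1 , + 0) (b , + (p ℕ.^ l))
consecutive-initial {p} l b b⊥p = record
  { q₋ = 0 ; q = p ℕ.^ l ; prev-den = refl ; cur-den = refl ; q₋≤q = ℕ.z≤n
  ; D∣q₋ = divides 0 refl ; D∣q = ∣-refl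
  ; ∣det∣≡D = ∣det∣≡pˡ
  ; prev-coprime = λ (i∣1 , _) → ∣1⇒≡1 i∣1
  ; cur-coprime = coprime-^ʳ b⊥p l }
  where
  ∣det∣≡pˡ : ∣ b * + 0 - + 1 * + (p ℕ.^ l) ∣ ≡ p ℕ.^ l
  ∣det∣≡pˡ rewrite ℤ.*-zeroʳ b | ℤ.*-identityˡ (+ (p ℕ.^ l)) | ℤ.+-identityˡ (- + (p ℕ.^ l)) =
    ℤ.∣-i∣≡∣i∣ (+ (p ℕ.^ l))

consecutive-step : ∀ {D} prev cur t → Consecutive D prev cur → ValidTerm t →
  CoprimePair (step prev cur t) → Consecutive D cur (step prev cur t)
consecutive-step {D} prev@(_ , _) cur@(_ , _) t@(e , a)
  record { q₋ = q₋ ; q = q ; prev-den = refl ; cur-den = refl ; q₋≤q = q₋≤q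
         ; D∣q₋ = D∣q₋ ; D∣q = D∣q ; ∣det∣≡D = ∣det∣≡D ; cur-coprime = cur-coprime }
  valid coprime
  with next-denominator t valid q₋≤q
... | m , eq , q≤m = record
  { q₋ = q ; q = m ; prev-den = refl ; cur-den = eq ; q₋≤q = q≤m
  ; D∣q₋ = D∣q ; D∣q = ∣-linear-combination (+ a) (sgn e) D∣q₋ D∣q eq
  ; ∣det∣≡D = trans (∣det-step∣ prev cur t) ∣det∣≡D
  ; prev-coprime = cur-coprime
  ; cur-coprime = subst (Coprime _) (cong ∣_∣ eq) coprime }

consecutive-last : ∀ {D} prev cur ts → Consecutive D prev cur →
  All ValidTerm ts → All CoprimePair (convsFrom prev cur ts) →
  uncurry (Consecutive D) (lastTwoFrom prev cur ts)
consecutive-last prev cur []       C _ _ = C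
consecutive-last prev cur (t ∷ ts) C (valid ∷ valids) (coprime ∷ coprimes) =
  consecutive-last cur (step prev cur t) ts (consecutive-step prev cur t C valid coprime)
    valids coprimes

BeatsSmallerDenominators : ℕ → ℤ → ℕ → ℤ → ℕ → Set
BeatsSmallerDenominators D P Q u v =
  ∀ (u′ : ℤ) (v′ : ℕ) → 0 ℕ.< v′ × Coprime (∣ u′ ∣) v′ × D ∣ v′ → ¬ (u′ ≡ u × v′ ≡ v) → v′ ≤ v →
    ∣ + v * P - u * + Q ∣ ℕ.< ∣ + v′ * P - u′ * + Q ∣

≤-∣cross∣ : ∀ {D p q} u {v} → Coprime ∣ p ∣ q → D ∣ q → D ∣ v → 0 ℕ.< v → v ℕ.< q →
  D ≤ ∣ + v * p - u * + q ∣
≤-∣cross∣ {D} {p} {q} u {v} p⊥q D∣q D∣v 0<v v<q = ∣⇒≤ {{ℕ.≢-nonZero ∣cross∣≢0}} D∣cross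
  where
  D∣cross : D ∣ ∣ + v * p - u * + q ∣
  D∣cross = ℤ.∣⇒∣ᵤ {+ D} (ℤ.∣m∣n⇒∣m-n (ℤ.∣m⇒∣m*n p (ℤ.∣ᵤ⇒∣ {+ D} {+ v} D∣v))
                                     (ℤ.∣n⇒∣m*n u (ℤ.∣ᵤ⇒∣ {+ D} {+ q} D∣q)))
  ∣cross∣≢0 : ∣ + v * p - u * + q ∣ ≢ 0
  ∣cross∣≢0 ∣cross∣≡0 = ℕ.<⇒≱ v<q (∣⇒≤ {{ℕ.>-nonZero 0<v}} (lowest-terms⇒∣ {p} {u} p⊥q pv≡uq))
    where
    pv≡uq : p * + v ≡ u * + q
    pv≡uq = trans (ℤ.*-comm p (+ v)) (ℤ.i-j≡0⇒i≡j _ _ (ℤ.∣i∣≡0⇒i≡0 ∣cross∣≡0))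

∣det∣≡D⇒q∣D : ∀ {p p₋ : ℤ} {q D} → ∣ p * + 0 - p₋ * + q ∣ ≡ D → q ∣ D
∣det∣≡D⇒q∣D {p} {p₋} {q} {D} ∣det∣≡D = divides ∣ p₋ ∣ (begin
  D                          ≡⟨ sym ∣det∣≡D ⟩
  ∣ p * + 0 - p₋ * + q ∣     ≡⟨ cong (λ x → ∣ x - p₋ * + q ∣) (ℤ.*-zeroʳ p) ⟩
  ∣ + 0 - p₋ * + q ∣         ≡⟨ cong ∣_∣ (ℤ.+-identityˡ (- (p₋ * + q))) ⟩
  ∣ - (p₋ * + q) ∣           ≡⟨ ℤ.∣-i∣≡∣i∣ (p₋ * + q) ⟩
  ∣ p₋ * + q ∣               ≡⟨ ℤ.abs-* p₋ (+ q) ⟩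
  ∣ p₋ ∣ ℕ.* q               ∎)
  where open ≡-Reasoning

not-best-between : ∀ {D p₋ q₋ p q} .{{_ : ℕ.NonZero D}} → ∣ p * + q₋ - p₋ * + q ∣ ≡ D →
  Coprime ∣ p₋ ∣ q₋ → D ∣ q₋ → Coprime ∣ p ∣ q → D ∣ q →
  ∀ u {v} → 0 ℕ.< v → D ∣ v → q₋ ℕ.< v → v ℕ.< q → ¬ BeatsSmallerDenominators D p q u v
not-best-between {p₋ = p₋} {ℕ.zero} {p} ∣det∣≡D _ _ _ _ u 0<v D∣v _ v<q _ =
  ℕ.<⇒≱ v<q (ℕ.≤-trans (∣⇒≤ (∣det∣≡D⇒q∣D {p} {p₋} ∣det∣≡D)) (∣⇒≤ {{ℕ.>-nonZero 0<v}} D∣v))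
not-best-between {D} {p₋} {q₋@(ℕ.suc _)} {p} {q} ∣det∣≡D p₋⊥q₋ D∣q₋ p⊥q D∣q
  u {v} 0<v D∣v q₋<v v<q beats =
  ℕ.<⇒≱ cross<D (≤-∣cross∣ {p = p} u p⊥q D∣q D∣v 0<v v<q)
  where
  cross<D : ∣ + v * p - u * + q ∣ ℕ.< D
  cross<D = subst (_ ℕ.<_) (trans (cong (λ x → ∣ x - p₋ * + q ∣) (ℤ.*-comm (+ q₋) p)) ∣det∣≡D)
    (beats p₋ q₋ (ℕ.z<s , p₋⊥q₋ , D∣q₋) (λ (_ , q₋≡v) → ℕ.<⇒≢ q₋<v q₋≡v) (ℕ.<⇒≤ q₋<v))

not-best-between-consecutive : ∀ {D prev cur} .{{_ : ℕ.NonZero D}} → Consecutive D prev cur →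
  ∀ {P Q} → Coprime ∣ P ∣ Q → proj₁ cur * + Q ≡ P * proj₂ cur →
  ∀ u {v} → 0 ℕ.< v → D ∣ v → proj₂ prev < + v → + v < proj₂ cur →
  ¬ BeatsSmallerDenominators D P Q u v
not-best-between-consecutive {prev = p₋ , _} {p , _}
  record { q₋ = q₋ ; q = q ; prev-den = refl ; cur-den = refl ; D∣q₋ = D∣q₋ ; D∣q = D∣q
         ; ∣det∣≡D = ∣det∣≡D ; prev-coprime = prev-coprime ; cur-coprime = cur-coprime }
  {P} P⊥Q value u 0<v D∣v (+<+ q₋<v) (+<+ v<q)
  with lowest-terms-unique {p} {P} {{ℕ.>-nonZero (ℕ.<-trans 0<v v<q)}} cur-coprime P⊥Q value
... | refl , refl =
  not-best-between {p₋ = p₋} ∣det∣≡D prev-coprime D∣q₋ cur-coprime D∣q u 0<v D∣v q₋<v v<q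

mainTheorem8 : (p : ℕ) → Prime p → (l : ℕ) → 1 ≤ l →
    (P : ℤ) (Q : ℕ) → InX p l P Q →
    (E : CF) → MaxPlus p l P Q E →
    (u : ℤ) (v : ℕ) → InX p l u v →
    qPrev p l E < + v → + v < qLast p l E →
    ¬ BestApprox p l P Q u v
mainTheorem8 p p-prime l _ P Q (_ , P⊥Q , _) E (((b⊥p , valid , _ , coprime) , value) , _)
  u v (0<v , _ , pˡ∣v) q₋<v v<q (_ , beats) =
  not-best-between-consecutive {{ℕ.m^n≢0 p l}} last P⊥Q value u 0<v pˡ∣v q₋<v v<q beats
  where
  instance _ = prime⇒nonZero p-prime
  last : uncurry (Consecutive (p ℕ.^ l)) (lastTwo p l E)
  last = consecutive-last _ _ (terms E) (consecutive-initial l (b E) b⊥p) valid coprime
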